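{- Let $G$ be a finite cyclic group. The following are equivalent: (1) each weakly half-factorial subset of $G$ is half-factorial; (2) each subset of $G$ that is not half-factorial contains a subset of cardinality two that is not half-factorial.
   Context: For $G_0\subseteq G$, a sequence over $G_0$ is a finite unordered list $S=g_1\cdots g_\ell$ of elements of $G_0$, with cross number $\mathsf k(S)=\sum_i 1/\operatorname{ord}(g_i)$. Minimal zero-sum sequences over $G_0$ are non-empty sequences with sum $0$ and no proper non-empty zero-sum subsequence; $\mathcal B(G_0)$ is the monoid (under concatenation) of zero-sum sequences over $G_0$, whose atoms are the minimal zero-sum sequences. $G_0$ is half-factorial if every element of $\mathcal B(G_0)$ has all its factorizations into minimal zero-sum sequences of the same length. $G_0$ is weakly half-factorial if $\mathsf k(A)\in\mathbb N$ for every minimal zero-sum sequence $A$ over $G_0$. -}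

module Defs where

open import Data.Nat as ℕ using (ℕ; zero; suc; _+_; _*_; _≤_; _<_; NonZero; ≢-nonZero)
open import Data.Nat.DivMod using (_/_)
open import Data.Nat.Divisibility using (_∣_)
open import Data.Nat.ListAction using (sum)
open import Data.Nat.GCD using (gcd; gcd[m,n]≢0; n/gcd[m,n]≢0)
open import Data.Fin using (Fin; toℕ)
open import Data.Fin.Subset using (Subset; _∈_)
open import Data.List using (List; []; _∷_; tabulate; foldr; length)
open import Data.List.Relation.Unary.All using (All)
open import Data.Integer using (+_)
open import Data.Rational as ℚ using (ℚ; 0ℚ)
open import Data.Product using (Σ; ∃; _×_)
open import Data.Sum using (inj₂)
open import Relation.Binary.PropositionalEquality using (_≡_; _≗_)

-- The finite cyclic group G is ℤ/nℤ (n ≥ 1), with elements represented by Fin n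
-- (g ↦ toℕ g mod n).  Subsets G₀ ⊆ G are `Subset n`.

module _ (n : ℕ) .{{n≢0 : NonZero n}} where

  gcd-nonZero : (g : Fin n) → NonZero (gcd (toℕ g) n)
  gcd-nonZero g = ≢-nonZero (gcd[m,n]≢0 (toℕ g) n (inj₂ (ℕ.≢-nonZero⁻¹ n)))

  ord : Fin n → ℕ
  ord g = (n / gcd (toℕ g) n) {{gcd-nonZero g}}

  ord-nonZero : (g : Fin n) → NonZero (ord g)
  ord-nonZero g = ≢-nonZero (n/gcd[m,n]≢0 (toℕ g) n {{gcd≢0 = gcd-nonZero g}})

  -- A sequence over G (a finite unordered list = multiset) is given by its
  -- multiplicity function: S g = number of occurrences of g in S.
  Seq : Set
  Seq = Fin n → ℕ

  ε : Seq
  ε _ = 0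

  _·_ : Seq → Seq → Seq
  (S · T) g = S g + T g

  prod : List Seq → Seq
  prod = foldr _·_ ε

  ∣_∣ₛ : Seq → ℕ
  ∣ S ∣ₛ = sum (tabulate S)

  -- sum σ(S) as a natural number representative; σ(S) = 0 in ℤ/n iff n ∣ it
  σ : Seq → ℕ
  σ S = sum (tabulate (λ g → S g * toℕ g))

  ZeroSum : Seq → Set
  ZeroSum S = n ∣ σ S

  NonEmpty : Seq → Set
  NonEmpty S = 0 < ∣ S ∣ₛ

  _≼_ : Seq → Seq → Set
  T ≼ S = ∀ g → T g ≤ S g

  Over : Subset n → Seq → Set
  Over G₀ S = ∀ g → 0 < S g → g ∈ G₀

  MinimalZeroSum : Seq → Set
  MinimalZeroSum S = NonEmpty S × ZeroSum S ×
    (∀ T → T ≼ S → NonEmpty T → ZeroSum T → T ≗ S)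

  Atom : Subset n → Seq → Set
  Atom G₀ A = Over G₀ A × MinimalZeroSum A

  InB : Subset n → Seq → Set
  InB G₀ B = Over G₀ B × ZeroSum B

  Factorization : Subset n → Seq → List Seq → Set
  Factorization G₀ B fs = All (Atom G₀) fs × prod fs ≗ B

  k : Seq → ℚ
  k S = foldr ℚ._+_ 0ℚ (tabulate (λ g → ((+ S g) ℚ./ ord g) {{ord-nonZero g}}))

  HalfFactorial : Subset n → Set
  HalfFactorial G₀ = ∀ B → InB G₀ B → ∀ fs gs →
    Factorization G₀ B fs → Factorization G₀ B gs → length fs ≡ length gs

  WeaklyHalfFactorial : Subset n → Set
  WeaklyHalfFactorial G₀ = ∀ A → Atom G₀ A → ∃ λ (m : ℕ) → k A ≡ (+ m) ℚ./ 1

module Submission where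

-- Everything is measured by the integer cross number K(S) = Σ S(g)·gcd(g,n),
-- which equals n·k(S) (CrossNumber).

open import Defs
open import Data.Nat as ℕ
  using (ℕ; zero; suc; _+_; _*_; _∸_; _≤_; _<_; z≤n; s≤s; NonZero; pred; _≟_; _<?_; _≤?_)
open import Data.Nat.Properties
open import Data.Nat.Induction using (<-wellFounded)
open import Induction.WellFounded using (Acc; acc)
open import Data.Nat.Divisibility
open import Data.Nat.GCD
open import Data.Nat.Coprimality using (Coprime; coprime-/gcd; coprime-divisor; coprime⇒gcd≡1)
open import Data.Nat.LCM using (lcm; m∣lcm[m,n]; n∣lcm[m,n]; lcm-least)
open import Data.Nat.DivMod using (m/n*n≡m; m*[n/m]≡n)
import Data.Nat.Coprimality as Coprime
open import Data.Nat.ListAction using (sum)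
open import Data.Nat.Tactic.RingSolver using (solve-∀)
import Data.Integer as ℤ
import Data.Integer.Properties as ℤ
open import Data.Rational as ℚ using (ℚ; toℚᵘ)
import Data.Rational.Properties as ℚ
open import Data.Rational.Unnormalised as ℚᵘ using (ℚᵘ; *≡*; _≃_)
import Data.Rational.Unnormalised.Properties as ℚᵘ
open import Data.Fin as Fin using (Fin; zero; suc; toℕ)
import Data.Fin.Properties as Fin
open import Data.Fin.Subset using (Subset; _∈_; _⊆_; ∣_∣; inside; outside; ⁅_⁆; _∪_)
open import Data.Fin.Subset.Properties
  using (_∈?_; drop-there; x∈p∪q⁺; x∈p∪q⁻; x∈⁅x⁆; x∈⁅y⁆⇒x≡y; ∣⁅x⁆∣≡1; ∪-identityˡ; ∪-identityʳ)
open import Data.Vec using ([]; _∷_; here; there)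
open import Data.List using (List; []; _∷_; tabulate; foldr; length; _++_; replicate; concat)
open import Data.List.Properties using (length-++; length-replicate)
open import Data.List.Relation.Unary.All using (All; []; _∷_)
import Data.List.Relation.Unary.All.Properties as All
open import Data.Product using (Σ; ∃; _×_; _,_; proj₁; proj₂)
open import Data.Sum using (_⊎_; inj₁; inj₂; [_,_]′)
open import Data.Empty using (⊥-elim)
open import Function using (_∘_; id)
open import Function.Bundles using (_⇔_; mk⇔; Equivalence)
open import Relation.Binary.PropositionalEquality
open import Relation.Nullary using (¬_; Dec; yes; no)
open import Relation.Nullary.Decidable using (_×-dec_; _→-dec_; ¬?; map′)

module FiniteSums where

  ∑ : ∀ {m} → (Fin m → ℕ) → ℕ
  ∑ f = sum (tabulate f)

  ∑-cong : ∀ {m} {f g : Fin m → ℕ} → f ≗ g → ∑ f ≡ ∑ g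
  ∑-cong {zero}  e = refl
  ∑-cong {suc m} e = cong₂ _+_ (e zero) (∑-cong (e ∘ suc))

  ∑-+ : ∀ {m} (f g : Fin m → ℕ) → ∑ (λ i → f i + g i) ≡ ∑ f + ∑ g
  ∑-+ {zero}  f g = refl
  ∑-+ {suc m} f g rewrite ∑-+ (f ∘ suc) (g ∘ suc) =
    +-assoc-comm (f zero) (g zero) (∑ (f ∘ suc)) (∑ (g ∘ suc))
    where
    +-assoc-comm : ∀ a b c d → (a + b) + (c + d) ≡ (a + c) + (b + d)
    +-assoc-comm = solve-∀

  ∑-*ˡ : ∀ {m} (a : ℕ) (f : Fin m → ℕ) → ∑ (λ i → a * f i) ≡ a * ∑ f
  ∑-*ˡ {zero}  a f = sym (*-zeroʳ a)
  ∑-*ˡ {suc m} a f rewrite ∑-*ˡ a (f ∘ suc) = sym (*-distribˡ-+ a (f zero) _)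

  ∑-zero : ∀ {m} (f : Fin m → ℕ) → (∀ i → f i ≡ 0) → ∑ f ≡ 0
  ∑-zero {zero}  f e = refl
  ∑-zero {suc m} f e rewrite e zero = ∑-zero (f ∘ suc) (e ∘ suc)

  ∑-single : ∀ {m} (f : Fin m → ℕ) (x : Fin m) → (∀ i → i ≢ x → f i ≡ 0) → ∑ f ≡ f x
  ∑-single {suc m} f zero e =
    trans (cong (f zero +_) (∑-zero (f ∘ suc) (λ i → e (suc i) λ ()))) (+-identityʳ _)
  ∑-single {suc m} f (suc x) e rewrite e zero (λ ()) =
    ∑-single (f ∘ suc) x (λ i i≢x → e (suc i) (i≢x ∘ Fin.suc-injective))

  ∑-mono : ∀ {m} {f g : Fin m → ℕ} → (∀ i → f i ≤ g i) → ∑ f ≤ ∑ g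
  ∑-mono {zero}  le = z≤n
  ∑-mono {suc m} le = +-mono-≤ (le zero) (∑-mono (le ∘ suc))

  ∑-mono-< : ∀ {m} {f g : Fin m → ℕ} → (∀ i → f i ≤ g i) → ∀ x → f x < g x → ∑ f < ∑ g
  ∑-mono-< {suc m} le zero    lt = +-mono-<-≤ lt (∑-mono (le ∘ suc))
  ∑-mono-< {suc m} le (suc x) lt = +-mono-≤-< (le zero) (∑-mono-< (le ∘ suc) x lt)

  term≤∑ : ∀ {m} (f : Fin m → ℕ) x → f x ≤ ∑ f
  term≤∑ {suc m} f zero    = m≤m+n (f zero) _
  term≤∑ {suc m} f (suc x) = ≤-trans (term≤∑ (f ∘ suc) x) (m≤n+m _ (f zero))

  ∑-support-≤ : ∀ {m} (G : Subset m) (M : ℕ) (f : Fin m → ℕ) →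
    (∀ i → i ∈ G → f i ≤ M) → (∀ i → ¬ i ∈ G → f i ≡ 0) → ∑ f ≤ ∣ G ∣ * M
  ∑-support-≤ {zero}  []            M f bound out = z≤n
  ∑-support-≤ {suc m} (inside ∷ G)  M f bound out =
    +-mono-≤ (bound zero here)
      (∑-support-≤ G M (f ∘ suc) (λ i i∈ → bound (suc i) (there i∈)) (λ i i∉ → out (suc i) (i∉ ∘ drop-there)))
  ∑-support-≤ {suc m} (outside ∷ G) M f bound out rewrite out zero (λ ()) =
    ∑-support-≤ G M (f ∘ suc) (λ i i∈ → bound (suc i) (there i∈)) (λ i i∉ → out (suc i) (i∉ ∘ drop-there))

open FiniteSums

module BoundedSearch where

  cons : ∀ {m} → ℕ → (Fin m → ℕ) → Fin (suc m) → ℕ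
  cons v f zero    = v
  cons v f (suc i) = f i

  ∃≤? : ∀ {m} (B : Fin m → ℕ) (P : (Fin m → ℕ) → Set) →
        (∀ {S T} → S ≗ T → P S → P T) → (∀ S → Dec (P S)) →
        Dec (∃ λ T → (∀ i → T i ≤ B i) × P T)
  ∃≤? {zero} B P resp P? with P? (λ ())
  ... | yes p = yes ((λ ()) , (λ ()) , p)
  ... | no ¬p = no λ (T , _ , pT) → ¬p (resp (λ ()) pT)
  ∃≤? {suc m} B P resp P? with anyUpTo? tail? (suc (B zero))
    where
    tail? : ∀ v → Dec (∃ λ T → (∀ i → T i ≤ B (suc i)) × P (cons v T))
    tail? v = ∃≤? (B ∘ suc) (P ∘ cons v)
                (λ e → resp λ { zero → refl ; (suc i) → e i }) (P? ∘ cons v)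
  ... | yes (v , s≤s v≤ , T , T≤ , p) = yes (cons v T , (λ { zero → v≤ ; (suc i) → T≤ i }) , p)
  ... | no none = no λ (T , T≤ , pT) →
    none (T zero , s≤s (T≤ zero) , T ∘ suc , T≤ ∘ suc ,
          resp (λ { zero → refl ; (suc i) → refl }) pT)

open BoundedSearch

module Cyclic (n : ℕ) .{{n≢0 : NonZero n}} where

  -- gcdₙ g = gcd(g, n) is the index of ⟨g⟩ in ℤ/nℤ, so that ordₙ g · gcdₙ g = n;
  -- it turns the cross number into an integer:  n · k(S) = Σ S(g) · gcdₙ g.
  gcdₙ : Fin n → ℕ
  gcdₙ g = gcd (toℕ g) n

  ordₙ : Fin n → ℕ
  ordₙ = ord n

  ord*gcd≡n : ∀ g → ordₙ g * gcdₙ g ≡ n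
  ord*gcd≡n g = m/n*n≡m {{gcd-nonZero n g}} (gcd[m,n]∣n (toℕ g) n)

  ordₙ>0 : ∀ g → 0 < ordₙ g
  ordₙ>0 g = ℕ.>-nonZero⁻¹ (ordₙ g) {{ord-nonZero n g}}

  ordₙ≤n : ∀ g → ordₙ g ≤ n
  ordₙ≤n g = subst (ordₙ g ≤_) (ord*gcd≡n g) (m≤m*n (ordₙ g) (gcdₙ g) {{gcd-nonZero n g}})

  n∣ord*g : ∀ g → n ∣ ordₙ g * toℕ g
  n∣ord*g g = divides q (begin
      ordₙ g * toℕ g          ≡⟨ cong (ordₙ g *_) (_∣_.equality gcd∣g) ⟩
      ordₙ g * (q * gcdₙ g)   ≡⟨ x*[y*z]≡y*[x*z] (ordₙ g) q (gcdₙ g) ⟩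
      q * (ordₙ g * gcdₙ g)   ≡⟨ cong (q *_) (ord*gcd≡n g) ⟩
      q * n                   ∎)
    where
    open ≡-Reasoning
    gcd∣g = gcd[m,n]∣m (toℕ g) n
    q = quotient gcd∣g
    x*[y*z]≡y*[x*z] : ∀ x y z → x * (y * z) ≡ y * (x * z)
    x*[y*z]≡y*[x*z] = solve-∀

  -- j · g ≡ 0 (mod n) forces ordₙ g ∣ j: write g = q · gcdₙ g with q coprime
  -- to ordₙ g = n / gcdₙ g, cancel gcdₙ g and apply Euclid's lemma.
  ord∣ : ∀ g j → n ∣ j * toℕ g → ordₙ g ∣ j
  ord∣ g j n∣jg = coprime-divisor coprime ord∣q*j
    where
    gcd∣g = gcd[m,n]∣m (toℕ g) n
    q = quotient gcd∣g
    coprime : Coprime (ordₙ g) q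
    coprime = subst (Coprime (ordₙ g)) (n/m≡quotient gcd∣g {{gcd-nonZero n g}})
                    (Coprime.sym (coprime-/gcd (toℕ g) n {{gcd-nonZero n g}}))
    ord*gcd∣j*q*gcd : ordₙ g * gcdₙ g ∣ (j * q) * gcdₙ g
    ord*gcd∣j*q*gcd = subst₂ _∣_ (sym (ord*gcd≡n g))
      (trans (cong (j *_) (_∣_.equality gcd∣g)) (sym (*-assoc j q (gcdₙ g)))) n∣jg
    ord∣q*j : ordₙ g ∣ q * j
    ord∣q*j = subst (ordₙ g ∣_) (*-comm j q) (*-cancelʳ-∣ (gcdₙ g) {{gcd-nonZero n g}} ord*gcd∣j*q*gcd)

  single : Fin n → ℕ → Seq n
  single x j y with x Fin.≟ y
  ... | yes _ = j
  ... | no  _ = 0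

  single-≡ : ∀ x j → single x j x ≡ j
  single-≡ x j with x Fin.≟ x
  ... | yes _   = refl
  ... | no  x≢x = ⊥-elim (x≢x refl)

  single-≢ : ∀ x j y → y ≢ x → single x j y ≡ 0
  single-≢ x j y y≢x with x Fin.≟ y
  ... | yes x≡y = ⊥-elim (y≢x (sym x≡y))
  ... | no  _   = refl

  scale : ℕ → Seq n → Seq n
  scale j S g = j * S g

  -- weighted length  Σ S(g) · h(g).  The sum σ(S), the length |S| and the
  -- integer cross number K(S) = n · k(S) are all weighted lengths.
  weight : (Fin n → ℕ) → Seq n → ℕ
  weight h S = ∑ λ g → S g * h g

  K : Seq n → ℕ
  K = weight gcdₙ

  weight-cong : ∀ h {S T} → S ≗ T → weight h S ≡ weight h T
  weight-cong h S≗T = ∑-cong λ g → cong (_* h g) (S≗T g)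

  weight-· : ∀ h S T → weight h ((_·_) n S T) ≡ weight h S + weight h T
  weight-· h S T = trans (∑-cong λ g → *-distribʳ-+ (h g) (S g) (T g))
                         (∑-+ (λ g → S g * h g) (λ g → T g * h g))

  weight-scale : ∀ h j S → weight h (scale j S) ≡ j * weight h S
  weight-scale h j S = trans (∑-cong λ g → *-assoc j (S g) (h g)) (∑-*ˡ j (λ g → S g * h g))

  weight-single : ∀ h x j → weight h (single x j) ≡ j * h x
  weight-single h x j =
    trans (∑-single _ x λ y y≢x → cong (_* h y) (single-≢ x j y y≢x))
          (cong (_* h x) (single-≡ x j))

  length-cong : ∀ {S T} → S ≗ T → ∣_∣ₛ n S ≡ ∣_∣ₛ n T
  length-cong = ∑-cong

  length-single : ∀ x j → ∣_∣ₛ n (single x j) ≡ j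
  length-single x j = trans (∑-single _ x (single-≢ x j)) (single-≡ x j)

  zeroSum-cong : ∀ {S T} → S ≗ T → ZeroSum n S → ZeroSum n T
  zeroSum-cong S≗T = subst (n ∣_) (weight-cong toℕ S≗T)

  nonEmpty-cong : ∀ {S T} → S ≗ T → NonEmpty n S → NonEmpty n T
  nonEmpty-cong S≗T = subst (0 <_) (length-cong S≗T)

  supported-single : ∀ T x → (∀ y → y ≢ x → T y ≡ 0) → T ≗ single x (T x)
  supported-single T x T0 y with y Fin.≟ x
  ... | yes refl = sym (single-≡ x (T x))
  ... | no  y≢x  = trans (T0 y y≢x) (sym (single-≢ x (T x) y y≢x))

module Atoms (n : ℕ) .{{n≢0 : NonZero n}} where
  open Cyclic n

  _≼ₙ_ : Seq n → Seq n → Set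
  _≼ₙ_ = _≼_ n

  ≗? : (S T : Seq n) → Dec (S ≗ T)
  ≗? S T = Fin.all? λ g → S g ≟ T g

  OtherZeroSum : Seq n → Seq n → Set
  OtherZeroSum S T = NonEmpty n T × ZeroSum n T × ¬ T ≗ S

  ProperZeroSumIn : Seq n → Set
  ProperZeroSumIn S = ∃ λ T → T ≼ₙ S × OtherZeroSum S T

  properZeroSumIn? : ∀ S → Dec (ProperZeroSumIn S)
  properZeroSumIn? S = ∃≤? S (OtherZeroSum S)
    (λ T≗U (ne , zs , T≢S) → nonEmpty-cong T≗U ne , zeroSum-cong T≗U zs ,
                             λ U≗S → T≢S (λ g → trans (T≗U g) (U≗S g)))
    (λ T → (0 <? ∣_∣ₛ n T) ×-dec (n ∣? σ n T) ×-dec ¬? (≗? T S))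

  Minimality : Seq n → Set
  Minimality S = ∀ T → T ≼ₙ S → NonEmpty n T → ZeroSum n T → T ≗ S

  minimality⇔noProper : ∀ S → Minimality S ⇔ (¬ ProperZeroSumIn S)
  minimality⇔noProper S = mk⇔
    (λ min (T , T≼S , ne , zs , T≢S) → T≢S (min T T≼S ne zs))
    (λ none T T≼S ne zs → unique none T T≼S ne zs (≗? T S))
    where
    unique : ¬ ProperZeroSumIn S → ∀ T → T ≼ₙ S → NonEmpty n T → ZeroSum n T →
             Dec (T ≗ S) → T ≗ S
    unique none T T≼S ne zs (yes T≗S) = T≗S
    unique none T T≼S ne zs (no  T≢S) = ⊥-elim (none (T , T≼S , ne , zs , T≢S))

  minimalZeroSum? : ∀ S → Dec (MinimalZeroSum n S)
  minimalZeroSum? S = (0 <? ∣_∣ₛ n S) ×-dec (n ∣? σ n S) ×-dec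
    map′ (Equivalence.from (minimality⇔noProper S)) (Equivalence.to (minimality⇔noProper S))
         (¬? (properZeroSumIn? S))

  atom? : ∀ G₀ S → Dec (Atom n G₀ S)
  atom? G₀ S = Fin.all? (λ g → (0 <? S g) →-dec (g ∈? G₀)) ×-dec minimalZeroSum? S

  atom-cong : ∀ {G₀ S T} → S ≗ T → Atom n G₀ S → Atom n G₀ T
  atom-cong S≗T (over , ne , zs , minimal) =
    (λ g pos → over g (subst (0 <_) (sym (S≗T g)) pos)) , nonEmpty-cong S≗T ne , zeroSum-cong S≗T zs ,
    λ U U≼T neU zsU g → trans (minimal U (λ g → subst (U g ≤_) (sym (S≗T g)) (U≼T g)) neU zsU g) (S≗T g)

  length-< : ∀ {T S} → T ≼ₙ S → ¬ T ≗ S → ∣_∣ₛ n T < ∣_∣ₛ n S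
  length-< {T} {S} T≼S T≢S with Fin.¬∀⟶∃¬ n (λ g → T g ≡ S g) (λ g → T g ≟ S g) T≢S
  ... | g , Tg≢Sg = ∑-mono-< T≼S g (≤∧≢⇒< (T≼S g) Tg≢Sg)

  atomBelow : ∀ S → NonEmpty n S → ZeroSum n S → ∃ λ A → A ≼ₙ S × MinimalZeroSum n A
  atomBelow S = go S (<-wellFounded (∣_∣ₛ n S))
    where
    go : ∀ S → Acc _<_ (∣_∣ₛ n S) → NonEmpty n S → ZeroSum n S →
         ∃ λ A → A ≼ₙ S × MinimalZeroSum n A
    go S (acc smaller) ne zs with properZeroSumIn? S
    ... | no none =
      S , (λ g → ≤-refl) , ne , zs , Equivalence.from (minimality⇔noProper S) none
    ... | yes (T , T≼S , neT , zsT , T≢S) with go T (smaller (length-< T≼S T≢S)) neT zsT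
    ...   | A , A≼T , minA = A , (λ g → ≤-trans (A≼T g) (T≼S g)) , minA

  zeroSum-single-ord : ∀ x → ZeroSum n (single x (ordₙ x))
  zeroSum-single-ord x = subst (n ∣_) (sym (weight-single toℕ x (ordₙ x))) (n∣ord*g x)

  nonEmpty-single-ord : ∀ x → NonEmpty n (single x (ordₙ x))
  nonEmpty-single-ord x = subst (0 <_) (sym (length-single x (ordₙ x))) (ordₙ>0 x)

  atom-≥ord : ∀ A → MinimalZeroSum n A → ∀ x → ordₙ x ≤ A x → single x (ordₙ x) ≗ A
  atom-≥ord A (_ , _ , minA) x ord≤Ax =
    minA (single x (ordₙ x)) below (nonEmpty-single-ord x) (zeroSum-single-ord x)
    where
    below : single x (ordₙ x) ≼ₙ A
    below y with y Fin.≟ x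
    ... | yes refl = subst (_≤ A x) (sym (single-≡ x (ordₙ x))) ord≤Ax
    ... | no  y≢x  = subst (_≤ A y) (sym (single-≢ x (ordₙ x) y y≢x)) z≤n

  atom-height : ∀ A → MinimalZeroSum n A → ∀ x → A x ≤ ordₙ x
  atom-height A minA x with A x ≤? ordₙ x
  ... | yes Ax≤ord = Ax≤ord
  ... | no  Ax≰ord = ⊥-elim (<⇒≢ ord<Ax (trans (sym (single-≡ x (ordₙ x))) (atom-≥ord A minA x (<⇒≤ ord<Ax) x)))
    where
    ord<Ax : ordₙ x < A x
    ord<Ax = ≰⇒> Ax≰ord

  -- x^{ord x} is an atom: a zero-sum x^j with 0 < j ≤ ord x has ord x ∣ j
  single-ord-minimal : ∀ x → MinimalZeroSum n (single x (ordₙ x))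
  single-ord-minimal x = nonEmpty-single-ord x , zeroSum-single-ord x , minimal
    where
    minimal : Minimality (single x (ordₙ x))
    minimal T T≼ ne zs y = trans (T≗xʲ y) (cong (λ j → single x j y) Tx≡ord)
      where
      T≗xʲ : T ≗ single x (T x)
      T≗xʲ = supported-single T x λ y y≢x → n≤0⇒n≡0 (subst (T y ≤_) (single-≢ x (ordₙ x) y y≢x) (T≼ y))
      Tx>0 : 0 < T x
      Tx>0 = subst (0 <_) (trans (length-cong T≗xʲ) (length-single x (T x))) ne
      ord∣Tx : ordₙ x ∣ T x
      ord∣Tx = ord∣ x (T x) (subst (n ∣_) (trans (weight-cong toℕ T≗xʲ) (weight-single toℕ x (T x))) zs)
      Tx≡ord : T x ≡ ordₙ x
      Tx≡ord = ≤-antisym (subst (T x ≤_) (single-≡ x (ordₙ x)) (T≼ x)) (∣⇒≤ {{ℕ.>-nonZero Tx>0}} ord∣Tx)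

*-pos⇒posˡ : ∀ m k → 0 < m * k → 0 < m
*-pos⇒posˡ (suc m) k _ = s≤s z≤n

*-pos⇒posʳ : ∀ m k → 0 < m * k → 0 < k
*-pos⇒posʳ m k = *-pos⇒posˡ k m ∘ subst (0 <_) (*-comm m k)

-- The key invariant is that K (= n·k)
-- is additive, so a factorization into atoms of cross number 1 has length
-- K(B)/n; conversely half-factoriality forces every atom A to have cross
-- number 1, by comparing two factorizations of A^n: into n copies of A and
-- into K(A) atoms of the form g^{ord g}.
module Factorizations (n : ℕ) .{{n≢0 : NonZero n}} where
  open Cyclic n
  open Atoms n

  ∏ : List (Seq n) → Seq n
  ∏ = prod n

  CrossNumberOne : Subset n → Set
  CrossNumberOne G₀ = ∀ A → Atom n G₀ A → K A ≡ n

  IntegralCrossNumbers : Subset n → Set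
  IntegralCrossNumbers G₀ = ∀ B → InB n G₀ B → n ∣ K B

  ∏-++ : ∀ xs ys → ∏ (xs ++ ys) ≗ (_·_) n (∏ xs) (∏ ys)
  ∏-++ []       ys g = refl
  ∏-++ (x ∷ xs) ys g = trans (cong (x g +_) (∏-++ xs ys g)) (sym (+-assoc (x g) _ _))

  ∏-replicate : ∀ j S → ∏ (replicate j S) ≗ scale j S
  ∏-replicate zero    S g = refl
  ∏-replicate (suc j) S g = cong (S g +_) (∏-replicate j S g)

  ∏-concat : ∀ {m} (L : Fin m → List (Seq n)) g → ∏ (concat (tabulate L)) g ≡ ∑ (λ i → ∏ (L i) g)
  ∏-concat {zero}  L g = refl
  ∏-concat {suc m} L g = trans (∏-++ (L zero) _ g) (cong (∏ (L zero) g +_) (∏-concat (L ∘ suc) g))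

  length-concat : ∀ {m} (L : Fin m → List (Seq n)) → length (concat (tabulate L)) ≡ ∑ (length ∘ L)
  length-concat {zero}  L = refl
  length-concat {suc m} L = trans (length-++ (L zero)) (cong (length (L zero) +_) (length-concat (L ∘ suc)))

  K-∏ : ∀ fs → K (∏ fs) ≡ foldr (λ f k → K f + k) 0 fs
  K-∏ []       = ∑-zero {n} (λ g → 0) (λ g → refl)
  K-∏ (f ∷ fs) = trans (weight-· gcdₙ f (∏ fs)) (cong (K f +_) (K-∏ fs))

  K-∏-atoms : ∀ G₀ → CrossNumberOne G₀ → ∀ fs → All (Atom n G₀) fs → K (∏ fs) ≡ length fs * n
  K-∏-atoms G₀ one fs atoms = trans (K-∏ fs) (go fs atoms)
    where
    go : ∀ fs → All (Atom n G₀) fs → foldr (λ f k → K f + k) 0 fs ≡ length fs * n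
    go []       []           = refl
    go (f ∷ fs) (af ∷ atoms) = cong₂ _+_ (one f af) (go fs atoms)

  crossNumberOne⇒halfFactorial : ∀ G₀ → CrossNumberOne G₀ → HalfFactorial n G₀
  crossNumberOne⇒halfFactorial G₀ one B _ fs gs (atoms-fs , ∏fs≗B) (atoms-gs , ∏gs≗B) =
    *-cancelʳ-≡ (length fs) (length gs) n (begin
      length fs * n  ≡⟨ sym (K-∏-atoms G₀ one fs atoms-fs) ⟩
      K (∏ fs)       ≡⟨ weight-cong gcdₙ (λ g → trans (∏fs≗B g) (sym (∏gs≗B g))) ⟩
      K (∏ gs)       ≡⟨ K-∏-atoms G₀ one gs atoms-gs ⟩
      length gs * n  ∎)
    where open ≡-Reasoning

  factorization : ∀ G₀ B → InB n G₀ B → ∃ (Factorization n G₀ B)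
  factorization G₀ B = go B (<-wellFounded (∣_∣ₛ n B))
    where
    go : ∀ B → Acc _<_ (∣_∣ₛ n B) → InB n G₀ B → ∃ (Factorization n G₀ B)
    go B (acc smaller) (over , zs) with 0 <? ∣_∣ₛ n B
    ... | no empty = [] , [] , λ g → sym (n≤0⇒n≡0 (≤-trans (term≤∑ B g) (≮⇒≥ empty)))
    ... | yes ne with atomBelow B ne zs
    ...   | A , A≼B , minA with go B′ (smaller |B′|<|B|) (overB′ , zsB′)
      where
      B′ : Seq n
      B′ g = B g ∸ A g
      B≗AB′ : B ≗ (_·_) n A B′
      B≗AB′ g = sym (m+[n∸m]≡n (A≼B g))
      overB′ : Over n G₀ B′
      overB′ g p = over g (<-≤-trans p (m∸n≤m (B g) (A g)))
      zsB′ : ZeroSum n B′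
      zsB′ = ∣m+n∣m⇒∣n (subst (n ∣_) (trans (weight-cong toℕ B≗AB′) (weight-· toℕ A B′)) zs)
                       (proj₁ (proj₂ minA))
      |B′|<|B| : ∣_∣ₛ n B′ < ∣_∣ₛ n B
      |B′|<|B| = subst (∣_∣ₛ n B′ <_) (sym (trans (length-cong B≗AB′) (∑-+ A B′)))
                       (m<n+m (∣_∣ₛ n B′) (proj₁ minA))
    ...     | fs , atoms , ∏fs≗B′ =
      A ∷ fs , ((λ g p → over g (<-≤-trans p (A≼B g))) , minA) ∷ atoms ,
      λ g → trans (cong (A g +_) (∏fs≗B′ g)) (m+[n∸m]≡n (A≼B g))

  crossNumberOne⇒integral : ∀ G₀ → CrossNumberOne G₀ → IntegralCrossNumbers G₀
  crossNumberOne⇒integral G₀ one B inB with factorization G₀ B inB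
  ... | fs , atoms , ∏fs≗B =
    divides (length fs) (trans (sym (weight-cong gcdₙ ∏fs≗B)) (K-∏-atoms G₀ one fs atoms))

  All-replicate : ∀ {P : Seq n → Set} j x → (0 < j → P x) → All P (replicate j x)
  All-replicate zero    x Px = []
  All-replicate (suc j) x Px = All.replicate⁺ (suc j) (Px (s≤s z≤n))

  -- S^n factors into the atoms g^{ord g}: one for each unit of S(g)·gcd(g,n),
  -- since ord g · gcd(g,n) = n.  This factorization has length K(S).
  ordPowersAt : Seq n → Fin n → List (Seq n)
  ordPowersAt S g = replicate (S g * gcdₙ g) (single g (ordₙ g))

  ordPowers : Seq n → List (Seq n)
  ordPowers S = concat (tabulate (ordPowersAt S))

  length-ordPowers : ∀ S → length (ordPowers S) ≡ K S
  length-ordPowers S = trans (length-concat (ordPowersAt S)) (∑-cong λ g → length-replicate (S g * gcdₙ g))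

  ordPowers-atoms : ∀ G₀ S → Over n G₀ S → All (Atom n G₀) (ordPowers S)
  ordPowers-atoms G₀ S over = All.concat⁺ (All.tabulate⁺ λ g →
    All-replicate (S g * gcdₙ g) _ λ pos → over-single g (*-pos⇒posˡ (S g) (gcdₙ g) pos) , single-ord-minimal g)
    where
    over-single : ∀ g → 0 < S g → Over n G₀ (single g (ordₙ g))
    over-single g Sg>0 y pos with g Fin.≟ y
    ... | yes refl = over g Sg>0
    ... | no  _    = ⊥-elim (<-irrefl refl pos)

  ∏-ordPowers : ∀ S → ∏ (ordPowers S) ≗ scale n S
  ∏-ordPowers S y = begin
    ∏ (ordPowers S) y                                   ≡⟨ ∏-concat (ordPowersAt S) y ⟩
    ∑ (λ g → ∏ (replicate (S g * gcdₙ g) (single g (ordₙ g))) y)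
      ≡⟨ ∑-cong (λ g → ∏-replicate (S g * gcdₙ g) (single g (ordₙ g)) y) ⟩
    ∑ (λ g → (S g * gcdₙ g) * single g (ordₙ g) y)
      ≡⟨ ∑-single _ y (λ g g≢y → trans (cong ((S g * gcdₙ g) *_) (single-≢ g (ordₙ g) y (g≢y ∘ sym)))
                                        (*-zeroʳ (S g * gcdₙ g))) ⟩
    (S y * gcdₙ y) * single y (ordₙ y) y                ≡⟨ cong ((S y * gcdₙ y) *_) (single-≡ y (ordₙ y)) ⟩
    (S y * gcdₙ y) * ordₙ y                             ≡⟨ a*b*c≡c*b*a (S y) (gcdₙ y) (ordₙ y) ⟩
    (ordₙ y * gcdₙ y) * S y                             ≡⟨ cong (_* S y) (ord*gcd≡n y) ⟩
    n * S y                                             ∎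
    where
    open ≡-Reasoning
    a*b*c≡c*b*a : ∀ a b c → (a * b) * c ≡ (c * b) * a
    a*b*c≡c*b*a = solve-∀

  -- for an atom A, A^n is both n copies of A and ordPowers A, of length K(A)
  halfFactorial⇒crossNumberOne : ∀ G₀ → HalfFactorial n G₀ → CrossNumberOne G₀
  halfFactorial⇒crossNumberOne G₀ hf A (overA , minA) = begin
    K A                         ≡⟨ sym (length-ordPowers A) ⟩
    length (ordPowers A)        ≡⟨ sym (hf (scale n A) (overAⁿ , zsAⁿ) (replicate n A) (ordPowers A) copies powers) ⟩
    length (replicate n A)      ≡⟨ length-replicate n ⟩
    n                           ∎
    where
    open ≡-Reasoning
    overAⁿ : Over n G₀ (scale n A)
    overAⁿ g pos = overA g (*-pos⇒posʳ n (A g) pos)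
    zsAⁿ : ZeroSum n (scale n A)
    zsAⁿ = subst (n ∣_) (sym (weight-scale toℕ n A)) (m∣m*n (σ n A))
    copies : Factorization n G₀ (scale n A) (replicate n A)
    copies = All.replicate⁺ n (overA , minA) , ∏-replicate n A
    powers : Factorization n G₀ (scale n A) (ordPowers A)
    powers = ordPowers-atoms G₀ A overA , ∏-ordPowers A

-- The cross number k(S) = Σ S(g)/ord(g) equals K(S)/n, since
-- S(g)/ord(g) = S(g)·gcd(g,n)/n.  Computations go through unnormalised
-- fractions, where equality is cross-multiplication.
module Fractions where
  open import Data.Integer using (+_)

  /-≃⇔ : ∀ a b d e .{{_ : NonZero d}} .{{_ : NonZero e}} →
         ((+ a) ℚᵘ./ d ≃ (+ b) ℚᵘ./ e) ⇔ (a * e ≡ b * d)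
  /-≃⇔ a b d e = mk⇔
    (λ a/d≃b/e → ℤ.+-injective (begin
       + (a * e)                            ≡⟨ ℤ.pos-* a e ⟩
       + a ℤ.* + e                          ≡⟨ sym (cong₂ ℤ._*_ (↥ a d) (↧ b e)) ⟩
       ℚᵘ.↥ (a / d) ℤ.* ℚᵘ.↧ (b / e)        ≡⟨ ℚᵘ.drop-*≡* a/d≃b/e ⟩
       ℚᵘ.↥ (b / e) ℤ.* ℚᵘ.↧ (a / d)        ≡⟨ cong₂ ℤ._*_ (↥ b e) (↧ a d) ⟩
       + b ℤ.* + d                          ≡⟨ sym (ℤ.pos-* b d) ⟩
       + (b * d)                            ∎))
    (λ ae≡bd → *≡* (begin
       ℚᵘ.↥ (a / d) ℤ.* ℚᵘ.↧ (b / e)        ≡⟨ cong₂ ℤ._*_ (↥ a d) (↧ b e) ⟩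
       + a ℤ.* + e                          ≡⟨ sym (ℤ.pos-* a e) ⟩
       + (a * e)                            ≡⟨ cong +_ ae≡bd ⟩
       + (b * d)                            ≡⟨ ℤ.pos-* b d ⟩
       + b ℤ.* + d                          ≡⟨ sym (cong₂ ℤ._*_ (↥ b e) (↧ a d)) ⟩
       ℚᵘ.↥ (b / e) ℤ.* ℚᵘ.↧ (a / d)        ∎))
    where
    open ≡-Reasoning
    _/_ : ℕ → (d : ℕ) → .{{NonZero d}} → ℚᵘ
    a / d = (+ a) ℚᵘ./ d
    ↥ : ∀ a d .{{_ : NonZero d}} → ℚᵘ.↥ (a / d) ≡ + a
    ↥ a d = ℚᵘ.↥[n/d]≡n (+ a) d
    ↧ : ∀ a d .{{_ : NonZero d}} → ℚᵘ.↧ (a / d) ≡ + d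
    ↧ a d = ℚᵘ.↧[n/d]≡d (+ a) d

  toℚᵘ-/ : ∀ a d .{{_ : NonZero d}} → toℚᵘ ((+ a) ℚ./ d) ≃ (+ a) ℚᵘ./ d
  toℚᵘ-/ a zero    = ⊥-elim (ℕ.≢-nonZero⁻¹ 0 refl)
  toℚᵘ-/ a (suc d) = ℚ.toℚᵘ-fromℚᵘ ((+ a) ℚᵘ./ suc d)

  +-/ : ∀ a b d .{{_ : NonZero d}} → (+ a) ℚᵘ./ d ℚᵘ.+ (+ b) ℚᵘ./ d ≃ (+ (a + b)) ℚᵘ./ d
  +-/ a b zero    = ⊥-elim (ℕ.≢-nonZero⁻¹ 0 refl)
  +-/ a b (suc d) = ℚᵘ.≃-trans (ℚᵘ.≃-reflexive (ℚᵘ./-cong numerator refl))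
    (Equivalence.from (/-≃⇔ (a * suc d + b * suc d) (a + b) (suc d * suc d) (suc d))
      (cross (a) (b) (suc d)))
    where
    numerator : + a ℤ.* + suc d ℤ.+ + b ℤ.* + suc d ≡ + (a * suc d + b * suc d)
    numerator = sym (trans (ℤ.pos-+ (a * suc d) _) (cong₂ ℤ._+_ (ℤ.pos-* a (suc d)) (ℤ.pos-* b (suc d))))
    cross : ∀ a b d → (a * d + b * d) * d ≡ (a + b) * (d * d)
    cross = solve-∀

  ∑-/ : ∀ {m} d .{{_ : NonZero d}} (a : Fin m → ℕ) (q : Fin m → ℚ) →
        (∀ i → toℚᵘ (q i) ≃ (+ a i) ℚᵘ./ d) →
        toℚᵘ (foldr ℚ._+_ ℚ.0ℚ (tabulate q)) ≃ (+ ∑ a) ℚᵘ./ d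
  ∑-/ {zero}  d a q qᵢ≃ = Equivalence.from (/-≃⇔ 0 0 1 d) refl
  ∑-/ {suc m} d a q qᵢ≃ =
    ℚᵘ.≃-trans (ℚ.toℚᵘ-homo-+ (q zero) _)
      (ℚᵘ.≃-trans (ℚᵘ.+-cong (qᵢ≃ zero) (∑-/ d (a ∘ suc) (q ∘ suc) (qᵢ≃ ∘ suc)))
                  (+-/ (a zero) (∑ (a ∘ suc)) d))

open Fractions

module CrossNumber (n : ℕ) .{{n≢0 : NonZero n}} where
  open import Data.Integer using (+_)
  open Cyclic n

  k≃K/n : ∀ S → toℚᵘ (k n S) ≃ (+ K S) ℚᵘ./ n
  k≃K/n S = ∑-/ n (λ g → S g * gcdₙ g) _ λ g →
    ℚᵘ.≃-trans (toℚᵘ-/ (S g) (ordₙ g) {{ord-nonZero n g}})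
      (Equivalence.from (/-≃⇔ (S g) (S g * gcdₙ g) (ordₙ g) n {{ord-nonZero n g}})
        (begin
          S g * n                   ≡⟨ cong (S g *_) (sym (ord*gcd≡n g)) ⟩
          S g * (ordₙ g * gcdₙ g)   ≡⟨ s*[o*c]≡[s*c]*o (S g) (ordₙ g) (gcdₙ g) ⟩
          (S g * gcdₙ g) * ordₙ g   ∎))
    where
    open ≡-Reasoning
    s*[o*c]≡[s*c]*o : ∀ s o c → s * (o * c) ≡ (s * c) * o
    s*[o*c]≡[s*c]*o = solve-∀

  integral⇔n∣K : ∀ S → (∃ λ (m : ℕ) → k n S ≡ (+ m) ℚ./ 1) ⇔ (n ∣ K S)
  integral⇔n∣K S = mk⇔
    (λ (m , k≡m) → divides m (trans (sym (*-identityʳ (K S)))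
       (Equivalence.to (/-≃⇔ (K S) m n 1)
         (ℚᵘ.≃-trans (ℚᵘ.≃-sym (k≃K/n S)) (ℚᵘ.≃-trans (ℚ.toℚᵘ-cong k≡m) (toℚᵘ-/ m 1))))))
    (λ (divides m K≡m*n) → m , ℚ.toℚᵘ-injective
       (ℚᵘ.≃-trans (k≃K/n S)
         (ℚᵘ.≃-trans (Equivalence.from (/-≃⇔ (K S) m n 1) (trans (*-identityʳ (K S)) K≡m*n))
                     (ℚᵘ.≃-sym (toℚᵘ-/ m 1)))))

-- lcm distributes over gcd (the divisibility we need): with d = gcd b c,
-- b = d·b′, c = d·c′ and gcd b′ c′ = 1, both lcm a b and lcm a c divide
-- multiples lcm a d · b′ and lcm a d · c′, whose gcd is lcm a d.
gcd-lcm-distrib : ∀ a b c .{{_ : NonZero (gcd b c)}} → gcd (lcm a b) (lcm a c) ∣ lcm a (gcd b c)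
gcd-lcm-distrib a b c =
  subst (gcd (lcm a b) (lcm a c) ∣_) L*gcd[b′,c′]≡L
    (subst (gcd (lcm a b) (lcm a c) ∣_) (sym (c*gcd[m,n]≡gcd[cm,cn] L b′ c′))
      (gcd-greatest (∣-trans (gcd[m,n]∣m (lcm a b) (lcm a c)) lcm[a,b]∣L*b′)
                    (∣-trans (gcd[m,n]∣n (lcm a b) (lcm a c)) lcm[a,c]∣L*c′)))
  where
  d  = gcd b c
  L  = lcm a d
  b′ = b ℕ./ d
  c′ = c ℕ./ d
  lcm-∣ : ∀ {x} → d * (x ℕ./ d) ≡ x → lcm a x ∣ L * (x ℕ./ d)
  lcm-∣ {x} d*x′≡x = lcm-least (∣m⇒∣m*n (x ℕ./ d) (m∣lcm[m,n] a d))
                              (subst (_∣ L * (x ℕ./ d)) d*x′≡x (*-monoˡ-∣ (x ℕ./ d) (n∣lcm[m,n] a d)))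
  lcm[a,b]∣L*b′ = lcm-∣ (m*[n/m]≡n (gcd[m,n]∣m b c))
  lcm[a,c]∣L*c′ = lcm-∣ (m*[n/m]≡n (gcd[m,n]∣n b c))
  L*gcd[b′,c′]≡L : L * gcd b′ c′ ≡ L
  L*gcd[b′,c′]≡L = trans (cong (L *_) (coprime⇒gcd≡1 (coprime-/gcd b c))) (*-identityʳ L)

-- The subgroup lattice of a cyclic group is
-- distributive, so an element r of ⟨x⟩ + ⟨y⟩ lies in ⟨x⟩∩⟨r⟩ + ⟨y⟩∩⟨r⟩.  All
-- of this is phrased with natural coefficients, negatives being represented
-- by multiples of n − 1.
module Splitting (n : ℕ) .{{n≢0 : NonZero n}} where

  p : ℕ
  p = pred n

  1+p≡n : suc p ≡ n
  1+p≡n = suc-pred n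

  cancelʳ : ∀ {x y} → n ∣ x + y → n ∣ y → n ∣ x
  cancelʳ {x} {y} n∣x+y = ∣m+n∣m⇒∣n (subst (n ∣_) (+-comm x y) n∣x+y)

  ∣-cancel : ∀ {t a b c} w → t + n * w ≡ a + b + c → n ∣ a → n ∣ b → n ∣ c → n ∣ t
  ∣-cancel w eq n∣a n∣b n∣c =
    cancelʳ (subst (n ∣_) (sym eq) (∣m∣n⇒∣m+n (∣m∣n⇒∣m+n n∣a n∣b) n∣c)) (m∣m*n w)

  negMultiple : ∀ u w → gcd u n ∣ w → ∃ λ C → n ∣ C * u + w
  negMultiple u w (divides t w≡t*d) with Bézout.identity (gcd-GCD u n)
  ... | Bézout.-+ x y d+xu≡yn = t * x , divides (t * y) (begin
      t * x * u + w              ≡⟨ cong (t * x * u +_) w≡t*d ⟩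
      t * x * u + t * d          ≡⟨ lhs≡ t x u d ⟩
      t * (d + x * u)            ≡⟨ cong (t *_) d+xu≡yn ⟩
      t * (y * n)                ≡⟨ sym (*-assoc t y n) ⟩
      t * y * n                  ∎)
    where
    open ≡-Reasoning
    d = gcd u n
    lhs≡ : ∀ t x u d → t * x * u + t * d ≡ t * (d + x * u)
    lhs≡ = solve-∀
  ... | Bézout.+- x y d+yn≡xu = p * t * x , divides (t * d + p * t * y) (begin
      p * t * x * u + w          ≡⟨ cong (p * t * x * u +_) w≡t*d ⟩
      p * t * x * u + t * d      ≡⟨ cong (_+ t * d) (assoc p t x u) ⟩
      p * t * (x * u) + t * d    ≡⟨ cong (λ z → p * t * z + t * d) (sym d+yn≡xu) ⟩
      p * t * (d + y * n) + t * d ≡⟨ cong (λ N → p * t * (d + y * N) + t * d) (sym 1+p≡n) ⟩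
      p * t * (d + y * suc p) + t * d ≡⟨ expand p t d y ⟩
      (t * d + p * t * y) * suc p ≡⟨ cong ((t * d + p * t * y) *_) 1+p≡n ⟩
      (t * d + p * t * y) * n    ∎)
    where
    open ≡-Reasoning
    d = gcd u n
    assoc : ∀ p t x u → p * t * x * u ≡ p * t * (x * u)
    assoc = solve-∀
    expand : ∀ p t d y → p * t * (d + y * suc p) + t * d ≡ (t * d + p * t * y) * suc p
    expand = solve-∀

  -- the coefficients exhibiting r = r₁ + r₂ with r₁ ∈ ⟨x⟩∩⟨r⟩, r₂ ∈ ⟨y⟩∩⟨r⟩:
  -- α·x + m·r ≡ 0, β·y + m′·r ≡ 0 and (m + m′ − 1)·r ≡ 0
  record Split (x y r : ℕ) : Set where
    field
      α m β m′ e : ℕ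
      αx+mr≡0  : n ∣ α * x + m * r
      βy+m′r≡0 : n ∣ β * y + m′ * r
      m+m′≡1+e : m + m′ ≡ suc e
      er≡0     : n ∣ e * r

  Split-swap : ∀ {x y r} → Split x y r → Split y x r
  Split-swap s = record
    { α = β ; m = m′ ; β = α ; m′ = m ; e = e
    ; αx+mr≡0 = βy+m′r≡0 ; βy+m′r≡0 = αx+mr≡0
    ; m+m′≡1+e = trans (+-comm m′ m) m+m′≡1+e ; er≡0 = er≡0 }
    where open Split s

  -- given r + W₂ = W₁ with W₁ ∈ ⟨x⟩∩⟨r⟩ and W₂ ∈ ⟨y⟩∩⟨r⟩, take
  -- α·x ≡ −W₁, m·r ≡ W₁, β·y ≡ W₂, m′·r ≡ −W₂
  split-from : ∀ x y r W₁ W₂ → r + W₂ ≡ W₁ →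
    gcd x n ∣ W₁ → gcd r n ∣ W₁ → gcd y n ∣ W₂ → gcd r n ∣ W₂ → Split x y r
  split-from x y r W₁ W₂ r+W₂≡W₁ x∣W₁ r∣W₁ y∣W₂ r∣W₂
    with negMultiple x W₁ x∣W₁ | negMultiple r (p * W₁) (∣n⇒∣m*n p r∣W₁)
       | negMultiple y (p * W₂) (∣n⇒∣m*n p y∣W₂) | negMultiple r W₂ r∣W₂
  ... | α , αx+W₁ | m₀ , m₀r+pW₁ | β , βy+pW₂ | m′ , m′r+W₂ = record
    { α = α ; m = n + m₀ ; β = β ; m′ = m′ ; e = p + m₀ + m′
    ; αx+mr≡0  = ∣-cancel W₁ (identity₁ 1+p≡n α x m₀ r W₁) αx+W₁ m₀r+pW₁ (m∣m*n r)
    ; βy+m′r≡0 = ∣-cancel W₂ (identity₂ 1+p≡n β y m′ r W₂) βy+pW₂ m′r+W₂ (n ∣0)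
    ; m+m′≡1+e = cong (λ N → N + m₀ + m′) (sym 1+p≡n)
    ; er≡0     = ∣-cancel W₂ (identity₃ 1+p≡n m₀ m′ r W₂ W₁ r+W₂≡W₁) m₀r+pW₁ m′r+W₂ (n ∣0) }
    where
    identity₁ : ∀ {n p} → suc p ≡ n → ∀ α x m₀ r W₁ →
      α * x + (n + m₀) * r + n * W₁ ≡ (α * x + W₁) + (m₀ * r + p * W₁) + n * r
    identity₁ {p = p} refl = core p
      where
      core : ∀ p α x m₀ r W₁ →
        α * x + (suc p + m₀) * r + suc p * W₁ ≡ (α * x + W₁) + (m₀ * r + p * W₁) + suc p * r
      core = solve-∀
    identity₂ : ∀ {n p} → suc p ≡ n → ∀ β y m′ r W₂ →
      β * y + m′ * r + n * W₂ ≡ (β * y + p * W₂) + (m′ * r + W₂) + 0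
    identity₂ {p = p} refl = core p
      where
      core : ∀ p β y m′ r W₂ → β * y + m′ * r + suc p * W₂ ≡ (β * y + p * W₂) + (m′ * r + W₂) + 0
      core = solve-∀
    identity₃ : ∀ {n p} → suc p ≡ n → ∀ m₀ m′ r W₂ W₁ → r + W₂ ≡ W₁ →
      (p + m₀ + m′) * r + n * W₂ ≡ (m₀ * r + p * W₁) + (m′ * r + W₂) + 0
    identity₃ {p = p} refl m₀ m′ r W₂ W₁ refl = core p m₀ m′ r W₂
      where
      core : ∀ p m₀ m′ r W₂ → (p + m₀ + m′) * r + suc p * W₂ ≡ (m₀ * r + p * (r + W₂)) + (m′ * r + W₂) + 0
      core = solve-∀

  -- With
  -- L_x = lcm(gcd(r,n), gcd(x,n)) and L_y likewise, ⟨x⟩∩⟨r⟩ = ⟨L_x⟩ and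
  -- ⟨y⟩∩⟨r⟩ = ⟨L_y⟩; distributivity gives D = gcd(L_x, L_y) ∣ r, and Bézout
  -- writes r = t·D as a difference of multiples of L_x and L_y.
  split : ∀ x y r a b → n ∣ a * x + b * y + r → Split x y r
  split x y r a b n∣ax+by+r = fromBézout (Bézout.identity (gcd-GCD Lx Ly))
    where
    gx = gcd x n
    gy = gcd y n
    gr = gcd r n
    Lx = lcm gr gx
    Ly = lcm gr gy
    D  = gcd Lx Ly
    instance
      gcd[gx,gy]≢0 : NonZero (gcd gx gy)
      gcd[gx,gy]≢0 = ℕ.≢-nonZero (gcd[m,n]≢0 gx gy (inj₁ (gcd[m,n]≢0 x n (inj₂ (ℕ.≢-nonZero⁻¹ n)))))
    gcd[gx,gy]∣r : gcd gx gy ∣ r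
    gcd[gx,gy]∣r = ∣m+n∣m⇒∣n (∣-trans gcd∣n n∣ax+by+r)
                             (∣m∣n⇒∣m+n (∣n⇒∣m*n a gcd∣x) (∣n⇒∣m*n b gcd∣y))
      where
      gcd∣x = ∣-trans (gcd[m,n]∣m gx gy) (gcd[m,n]∣m x n)
      gcd∣y = ∣-trans (gcd[m,n]∣n gx gy) (gcd[m,n]∣m y n)
      gcd∣n = ∣-trans (gcd[m,n]∣m gx gy) (gcd[m,n]∣n x n)
    D∣r : D ∣ r
    D∣r = ∣-trans (gcd-lcm-distrib gr gx gy) (lcm-least (gcd[m,n]∣m r n) gcd[gx,gy]∣r)
    t = quotient D∣r
    scaled : ∀ {W W′} → D + W ≡ W′ → r + t * W ≡ t * W′
    scaled {W} D+W≡W′ =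
      trans (cong (_+ t * W) (_∣_.equality D∣r))
            (trans (sym (*-distribˡ-+ t D W)) (cong (t *_) D+W≡W′))
    fromBézout : Bézout.Identity D Lx Ly → Split x y r
    fromBézout (Bézout.+- P Q D+QLy≡PLx) =
      split-from x y r (t * (P * Lx)) (t * (Q * Ly)) (scaled D+QLy≡PLx)
        (∣n⇒∣m*n t (∣n⇒∣m*n P (n∣lcm[m,n] gr gx))) (∣n⇒∣m*n t (∣n⇒∣m*n P (m∣lcm[m,n] gr gx)))
        (∣n⇒∣m*n t (∣n⇒∣m*n Q (n∣lcm[m,n] gr gy))) (∣n⇒∣m*n t (∣n⇒∣m*n Q (m∣lcm[m,n] gr gy)))
    fromBézout (Bézout.-+ P Q D+PLx≡QLy) = Split-swap
      (split-from y x r (t * (Q * Ly)) (t * (P * Lx)) (scaled D+PLx≡QLy)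
        (∣n⇒∣m*n t (∣n⇒∣m*n Q (n∣lcm[m,n] gr gy))) (∣n⇒∣m*n t (∣n⇒∣m*n Q (m∣lcm[m,n] gr gy)))
        (∣n⇒∣m*n t (∣n⇒∣m*n P (n∣lcm[m,n] gr gx))) (∣n⇒∣m*n t (∣n⇒∣m*n P (m∣lcm[m,n] gr gx))))

  balance : ∀ {a b c d e} f → a + b + c ≡ d + e + n * f →
            n ∣ b → n ∣ c → n ∣ e → ((n ∣ a) ⇔ (n ∣ d))
  balance {a} {b} {c} {d} {e} f eq n∣b n∣c n∣e = mk⇔
    (λ n∣a → cancelʳ (cancelʳ (subst (n ∣_) eq (∣m∣n⇒∣m+n (∣m∣n⇒∣m+n n∣a n∣b) n∣c)) (m∣m*n f)) n∣e)
    (λ n∣d → cancelʳ (cancelʳ (subst (n ∣_) (sym eq) (∣m∣n⇒∣m+n (∣m∣n⇒∣m+n n∣d n∣e) (m∣m*n f))) n∣c) n∣b)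

-- Induction on the size of the support: a
-- zero-sum B = x^a · y^b · R is traded, using a Split of σ(R) along x and y,
-- for sequences of smaller support and one sequence over {x, y}.
module LocalGlobal (n : ℕ) .{{n≢0 : NonZero n}} where
  open Cyclic n
  open Factorizations n using (IntegralCrossNumbers)
  open Splitting n

  pair : Fin n → Fin n → Subset n
  pair x y = ⁅ x ⁆ ∪ ⁅ y ⁆

  PairwiseIntegral : Subset n → Set
  PairwiseIntegral G₀ = ∀ x y → x ∈ G₀ → y ∈ G₀ → x ≢ y → IntegralCrossNumbers (pair x y)

  _⊑_ : Seq n → Seq n → Set
  S ⊑ B = ∀ g → 0 < S g → 0 < B g

  _⊏_ : Seq n → Seq n → Set
  S ⊏ B = S ⊑ B × ∃ λ z → 0 < B z × S z ≡ 0

  ⊑-over : ∀ {G₀ S B} → S ⊑ B → Over n G₀ B → Over n G₀ S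
  ⊑-over S⊑B over g Sg>0 = over g (S⊑B g Sg>0)

  indicator : ℕ → ℕ
  indicator zero    = 0
  indicator (suc _) = 1

  ∣supp∣ : Seq n → ℕ
  ∣supp∣ S = ∑ λ g → indicator (S g)

  ∣supp∣-< : ∀ {S B} → S ⊏ B → ∣supp∣ S < ∣supp∣ B
  ∣supp∣-< {S} {B} (S⊑B , z , Bz>0 , Sz≡0) =
    ∑-mono-< (λ g → indicator-mono (S g) (B g) (S⊑B g)) z
             (subst (λ s → indicator s < indicator (B z)) (sym Sz≡0) (indicator-pos Bz>0))
    where
    indicator-mono : ∀ s b → (0 < s → 0 < b) → indicator s ≤ indicator b
    indicator-mono zero    b       _   = z≤n
    indicator-mono (suc s) zero    pos with pos (s≤s z≤n)
    ... | ()
    indicator-mono (suc s) (suc b) _   = ≤-refl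
    indicator-pos : ∀ {b} → 0 < b → 0 < indicator b
    indicator-pos {suc b} _ = s≤s z≤n

  erase : Fin n → Seq n → Seq n
  erase x B g with g Fin.≟ x
  ... | yes _ = 0
  ... | no  _ = B g

  erase-≡ : ∀ x B → erase x B x ≡ 0
  erase-≡ x B with x Fin.≟ x
  ... | yes _   = refl
  ... | no  x≢x = ⊥-elim (x≢x refl)

  erase-≢ : ∀ x B g → g ≢ x → erase x B g ≡ B g
  erase-≢ x B g g≢x with g Fin.≟ x
  ... | yes g≡x = ⊥-elim (g≢x g≡x)
  ... | no  _   = refl

  erase-⊑ : ∀ x B → erase x B ⊑ B
  erase-⊑ x B g pos with g Fin.≟ x
  ... | yes _ = ⊥-elim (<-irrefl refl pos)
  ... | no  _ = pos

  weight-erase : ∀ h x B → weight h B ≡ B x * h x + weight h (erase x B)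
  weight-erase h x B = begin
    weight h B                                        ≡⟨ weight-cong h B≗x^Bx·erase ⟩
    weight h ((_·_) n (single x (B x)) (erase x B))   ≡⟨ weight-· h (single x (B x)) (erase x B) ⟩
    weight h (single x (B x)) + weight h (erase x B)  ≡⟨ cong (_+ weight h (erase x B)) (weight-single h x (B x)) ⟩
    B x * h x + weight h (erase x B)                  ∎
    where
    open ≡-Reasoning
    B≗x^Bx·erase : B ≗ (_·_) n (single x (B x)) (erase x B)
    B≗x^Bx·erase g = byCases (g Fin.≟ x)
      where
      byCases : Dec (g ≡ x) → B g ≡ single x (B x) g + erase x B g
      byCases (yes refl) = sym (trans (cong₂ _+_ (single-≡ g (B g)) (erase-≡ g B)) (+-identityʳ (B g)))
      byCases (no  g≢x)  = sym (cong₂ _+_ (single-≢ x (B x) g g≢x) (erase-≢ x B g g≢x))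

  ⊑-single·scale : ∀ {B R} x j m → 0 < B x → R ⊑ B → (_·_) n (single x j) (scale m R) ⊑ B
  ⊑-single·scale {B} {R} x j m Bx>0 R⊑B g pos with g Fin.≟ x
  ... | yes refl = Bx>0
  ... | no  g≢x  = R⊑B g (*-pos⇒posʳ m (R g) (subst (0 <_) (cong (_+ m * R g) (single-≢ x j g g≢x)) pos))

  weight-single·scale : ∀ h x j m R → weight h ((_·_) n (single x j) (scale m R)) ≡ j * h x + m * weight h R
  weight-single·scale h x j m R =
    trans (weight-· h (single x j) (scale m R)) (cong₂ _+_ (weight-single h x j) (weight-scale h m R))

  -- a zero-sum sequence supported on one element x is a power of x^{ord x}
  singleSupport-integral : ∀ B x → (∀ g → g ≢ x → B g ≡ 0) → ZeroSum n B → n ∣ K B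
  singleSupport-integral B x B0 zs with ord∣ x (B x) (subst (n ∣_) (weight-at-x toℕ) zs)
    where
    weight-at-x : ∀ h → weight h B ≡ B x * h x
    weight-at-x h = ∑-single _ x λ g g≢x → cong (_* h g) (B0 g g≢x)
  ... | divides q Bx≡q*ord = divides q (begin
    K B                        ≡⟨ ∑-single _ x (λ g g≢x → cong (_* gcdₙ g) (B0 g g≢x)) ⟩
    B x * gcdₙ x               ≡⟨ cong (_* gcdₙ x) Bx≡q*ord ⟩
    q * ordₙ x * gcdₙ x        ≡⟨ *-assoc q (ordₙ x) (gcdₙ x) ⟩
    q * (ordₙ x * gcdₙ x)      ≡⟨ cong (q *_) (ord*gcd≡n x) ⟩
    q * n                      ∎)
    where open ≡-Reasoning

  over-pair : ∀ x y a b → Over n (pair x y) ((_·_) n (single x a) (single y b))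
  over-pair x y a b g pos = byCases (g Fin.≟ x) (g Fin.≟ y)
    where
    byCases : Dec (g ≡ x) → Dec (g ≡ y) → g ∈ pair x y
    byCases (yes refl) _          = x∈p∪q⁺ (inj₁ (x∈⁅x⁆ g))
    byCases _          (yes refl) = x∈p∪q⁺ (inj₂ (x∈⁅x⁆ g))
    byCases (no g≢x)   (no g≢y)   =
      ⊥-elim (<-irrefl (sym (cong₂ _+_ (single-≢ x a g g≢x) (single-≢ y b g g≢y))) pos)

  weight-pair : ∀ h x y a b → weight h ((_·_) n (single x a) (single y b)) ≡ a * h x + b * h y
  weight-pair h x y a b =
    trans (weight-· h (single x a) (single y b)) (cong₂ _+_ (weight-single h x a) (weight-single h y b))

  -- the arithmetic behind the exchange  P · C₁ · C₂ = B · C₃ · (x^α y^β)^n  (TwoPoints.Exchange)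
  exchange : ∀ m m′ e → m + m′ ≡ suc e → ∀ a b α β X Y Z →
    ((a + p * α) * X + (b + p * β) * Y) + (α * X + m * Z) + (β * Y + m′ * Z)
      ≡ (a * X + b * Y + Z) + e * Z + n * (α * X + β * Y)
  exchange m m′ e m+m′≡1+e a b α β X Y Z = begin
    ((a + p * α) * X + (b + p * β) * Y) + (α * X + m * Z) + (β * Y + m′ * Z)
      ≡⟨ collect p a b α β m m′ X Y Z ⟩
    (a * X + b * Y + suc p * (α * X + β * Y)) + (m + m′) * Z
      ≡⟨ cong (λ k → (a * X + b * Y + suc p * (α * X + β * Y)) + k * Z) m+m′≡1+e ⟩
    (a * X + b * Y + suc p * (α * X + β * Y)) + suc e * Z
      ≡⟨ redistribute p a b α β e X Y Z ⟩
    (a * X + b * Y + Z) + e * Z + suc p * (α * X + β * Y)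
      ≡⟨ cong (λ N → (a * X + b * Y + Z) + e * Z + N * (α * X + β * Y)) 1+p≡n ⟩
    (a * X + b * Y + Z) + e * Z + n * (α * X + β * Y) ∎
    where
    open ≡-Reasoning
    collect : ∀ p a b α β m m′ X Y Z →
      ((a + p * α) * X + (b + p * β) * Y) + (α * X + m * Z) + (β * Y + m′ * Z)
        ≡ (a * X + b * Y + suc p * (α * X + β * Y)) + (m + m′) * Z
    collect = solve-∀
    redistribute : ∀ p a b α β e X Y Z →
      (a * X + b * Y + suc p * (α * X + β * Y)) + suc e * Z
        ≡ (a * X + b * Y + Z) + e * Z + suc p * (α * X + β * Y)
    redistribute = solve-∀

  module TwoPoints (B : Seq n) (x y : Fin n) (x≢y : x ≢ y) (Bx>0 : 0 < B x) (By>0 : 0 < B y) where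
    a b : ℕ
    a = B x
    b = B y

    R : Seq n
    R = erase y (erase x B)

    R⊑B : R ⊑ B
    R⊑B g pos = erase-⊑ x B g (erase-⊑ y (erase x B) g pos)

    Rx≡0 : R x ≡ 0
    Rx≡0 = trans (erase-≢ y (erase x B) x x≢y) (erase-≡ x B)

    Ry≡0 : R y ≡ 0
    Ry≡0 = erase-≡ y (erase x B)

    decomposition : ∀ h → weight h B ≡ a * h x + b * h y + weight h R
    decomposition h = begin
      weight h B                                   ≡⟨ weight-erase h x B ⟩
      a * h x + weight h (erase x B)               ≡⟨ cong (a * h x +_) (weight-erase h y (erase x B)) ⟩
      a * h x + (erase x B y * h y + weight h R)   ≡⟨ cong (λ k → a * h x + (k * h y + weight h R)) (erase-≢ x B y (x≢y ∘ sym)) ⟩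
      a * h x + (b * h y + weight h R)             ≡⟨ sym (+-assoc (a * h x) (b * h y) (weight h R)) ⟩
      a * h x + b * h y + weight h R               ∎
      where open ≡-Reasoning

    -- Given a Split of σ(R) along x and y, the sequences
    --   C₁ = x^α R^m,  C₂ = y^β R^{m′},  C₃ = R^e   (zero-sum, smaller support),
    --   P  = x^{a+(n−1)α} y^{b+(n−1)β}               (over {x, y})
    -- satisfy P · C₁ · C₂ = B · C₃ · (x^α y^β)^n.
    module Exchange (s : Split (toℕ x) (toℕ y) (σ n R)) where
      open Split s

      C₁ C₂ C₃ P : Seq n
      C₁ = (_·_) n (single x α) (scale m R)
      C₂ = (_·_) n (single y β) (scale m′ R)
      C₃ = scale e R
      P  = (_·_) n (single x (a + p * α)) (single y (b + p * β))

      C₁⊏B : C₁ ⊏ B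
      C₁⊏B = ⊑-single·scale x α m Bx>0 R⊑B , y , By>0 ,
             cong₂ _+_ (single-≢ x α y (x≢y ∘ sym)) (trans (cong (m *_) Ry≡0) (*-zeroʳ m))

      C₂⊏B : C₂ ⊏ B
      C₂⊏B = ⊑-single·scale y β m′ By>0 R⊑B , x , Bx>0 ,
             cong₂ _+_ (single-≢ y β x x≢y) (trans (cong (m′ *_) Rx≡0) (*-zeroʳ m′))

      C₃⊏B : C₃ ⊏ B
      C₃⊏B = (λ g pos → R⊑B g (*-pos⇒posʳ e (R g) pos)) , x , Bx>0 ,
             trans (cong (e *_) Rx≡0) (*-zeroʳ e)

      zsC₁ : ZeroSum n C₁
      zsC₁ = subst (n ∣_) (sym (weight-single·scale toℕ x α m R)) αx+mr≡0

      zsC₂ : ZeroSum n C₂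
      zsC₂ = subst (n ∣_) (sym (weight-single·scale toℕ y β m′ R)) βy+m′r≡0

      zsC₃ : ZeroSum n C₃
      zsC₃ = subst (n ∣_) (sym (weight-scale toℕ e R)) er≡0

      exchange-weights : ∀ h → weight h P + weight h C₁ + weight h C₂
                               ≡ weight h B + weight h C₃ + n * (α * h x + β * h y)
      exchange-weights h = begin
        weight h P + weight h C₁ + weight h C₂
          ≡⟨ cong₂ _+_ (cong₂ _+_ (weight-pair h x y (a + p * α) (b + p * β))
                                  (weight-single·scale h x α m R))
                       (weight-single·scale h y β m′ R) ⟩
        ((a + p * α) * h x + (b + p * β) * h y) + (α * h x + m * weight h R) + (β * h y + m′ * weight h R)
          ≡⟨ exchange m m′ e m+m′≡1+e a b α β (h x) (h y) (weight h R) ⟩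
        (a * h x + b * h y + weight h R) + e * weight h R + n * (α * h x + β * h y)
          ≡⟨ cong₂ (λ u v → u + v + n * (α * h x + β * h y)) (sym (decomposition h)) (sym (weight-scale h e R)) ⟩
        weight h B + weight h C₃ + n * (α * h x + β * h y) ∎
        where open ≡-Reasoning

  -- The inductive step: for zero-sum B over G₀ with distinct x, y in its
  -- support, P is zero-sum over {x, y} since C₁, C₂, C₃ and B are zero-sum; so
  -- n ∣ K(P), and with n ∣ K(Cᵢ) by induction the exchange gives n ∣ K(B).
  twoPoint-step : ∀ G₀ → PairwiseIntegral G₀ → ∀ B → InB n G₀ B →
    ∀ x y → x ≢ y → 0 < B x → 0 < B y →
    (∀ S → S ⊏ B → ZeroSum n S → n ∣ K S) → n ∣ K B
  twoPoint-step G₀ pairs B (over , zsB) x y x≢y Bx>0 By>0 smaller =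
    Equivalence.to (balance _ (exchange-weights gcdₙ) (smaller C₁ C₁⊏B zsC₁)
                            (smaller C₂ C₂⊏B zsC₂) (smaller C₃ C₃⊏B zsC₃)) n∣KP
    where
    open TwoPoints B x y x≢y Bx>0 By>0
    open Exchange (split (toℕ x) (toℕ y) (σ n R) a b (subst (n ∣_) (decomposition toℕ) zsB))

    zsP : ZeroSum n P
    zsP = Equivalence.from (balance _ (exchange-weights toℕ) zsC₁ zsC₂ zsC₃) zsB

    n∣KP : n ∣ K P
    n∣KP = pairs x y (over x Bx>0) (over y By>0) x≢y P (over-pair x y _ _ , zsP)

  localGlobal : ∀ G₀ → PairwiseIntegral G₀ → IntegralCrossNumbers G₀
  localGlobal G₀ pairs B = go B (<-wellFounded (∣supp∣ B))
    where
    go : ∀ B → Acc _<_ (∣supp∣ B) → InB n G₀ B → n ∣ K B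
    go B (acc smaller) (over , zs) with Fin.any? (λ g → 0 <? B g)
    ... | no empty = subst (n ∣_) (sym (∑-zero _ λ g → cong (_* gcdₙ g) (Bg≡0 g))) (n ∣0)
      where
      Bg≡0 : ∀ g → B g ≡ 0
      Bg≡0 g = n≤0⇒n≡0 (≮⇒≥ λ Bg>0 → empty (g , Bg>0))
    ... | yes (x , Bx>0) with Fin.any? (λ g → (0 <? B g) ×-dec ¬? (g Fin.≟ x))
    ...   | no onlyX = singleSupport-integral B x Bg≡0 zs
      where
      Bg≡0 : ∀ g → g ≢ x → B g ≡ 0
      Bg≡0 g g≢x = n≤0⇒n≡0 (≮⇒≥ λ Bg>0 → onlyX (g , Bg>0 , g≢x))
    ...   | yes (y , By>0 , y≢x) = twoPoint-step G₀ pairs B (over , zs) x y (y≢x ∘ sym) Bx>0 By>0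
      λ S S⊏B zsS → go S (smaller (∣supp∣-< S⊏B)) (⊑-over (proj₁ S⊏B) over , zsS)

∣⁅x⁆∪⁅y⁆∣≡2 : ∀ {m} (x y : Fin m) → x ≢ y → ∣ ⁅ x ⁆ ∪ ⁅ y ⁆ ∣ ≡ 2
∣⁅x⁆∪⁅y⁆∣≡2 zero    zero    x≢y = ⊥-elim (x≢y refl)
∣⁅x⁆∪⁅y⁆∣≡2 zero    (suc y) _   = cong suc (trans (cong ∣_∣ (∪-identityˡ ⁅ y ⁆)) (∣⁅x⁆∣≡1 y))
∣⁅x⁆∪⁅y⁆∣≡2 (suc x) zero    _   = cong suc (trans (cong ∣_∣ (∪-identityʳ ⁅ x ⁆)) (∣⁅x⁆∣≡1 x))
∣⁅x⁆∪⁅y⁆∣≡2 (suc x) (suc y) x≢y = ∣⁅x⁆∪⁅y⁆∣≡2 x y (x≢y ∘ cong suc)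

multiple<2n : ∀ {n k} → 0 < k → k < 2 * n → n ∣ k → k ≡ n
multiple<2n {n} k>0 k<2n (divides zero          k≡0)  = ⊥-elim (<-irrefl (sym k≡0) k>0)
multiple<2n {n} k>0 k<2n (divides (suc zero)    k≡n)  = trans k≡n (+-identityʳ n)
multiple<2n {n} k>0 k<2n (divides (suc (suc q)) k≡qn) =
  ⊥-elim (<⇒≱ k<2n (subst (2 * n ≤_) (sym k≡qn) (*-monoˡ-≤ n {2} {suc (suc q)} (s≤s (s≤s z≤n)))))

module TwoElementSubsets (n : ℕ) .{{n≢0 : NonZero n}} where
  open Cyclic n
  open Atoms n
  open Factorizations n
  open CrossNumber n
  open LocalGlobal n using (pair; PairwiseIntegral; localGlobal)

  weaklyHalfFactorial⇔ : ∀ G₀ → WeaklyHalfFactorial n G₀ ⇔ (∀ A → Atom n G₀ A → n ∣ K A)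
  weaklyHalfFactorial⇔ G₀ = mk⇔
    (λ whf A atom → Equivalence.to (integral⇔n∣K A) (whf A atom))
    (λ n∣K A atom → Equivalence.from (integral⇔n∣K A) (n∣K A atom))

  whf-⊆ : ∀ {G₁ G₀} → G₁ ⊆ G₀ → WeaklyHalfFactorial n G₀ → WeaklyHalfFactorial n G₁
  whf-⊆ G₁⊆G₀ whf A (over , minA) = whf A ((λ g pos → G₁⊆G₀ (over g pos)) , minA)

  pair-⊆ : ∀ {G₀ x y} → x ∈ G₀ → y ∈ G₀ → pair x y ⊆ G₀
  pair-⊆ {G₀} {x} {y} x∈G₀ y∈G₀ {z} z∈pair with x∈p∪q⁻ ⁅ x ⁆ ⁅ y ⁆ z∈pair
  ... | inj₁ z∈⁅x⁆ = subst (_∈ G₀) (sym (x∈⁅y⁆⇒x≡y x z∈⁅x⁆)) x∈G₀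
  ... | inj₂ z∈⁅y⁆ = subst (_∈ G₀) (sym (x∈⁅y⁆⇒x≡y y z∈⁅y⁆)) y∈G₀

  -- half-factoriality is a statement about equal lengths, hence ¬¬-stable
  halfFactorial-stable : ∀ G₀ → ¬ ¬ HalfFactorial n G₀ → HalfFactorial n G₀
  halfFactorial-stable G₀ ¬¬hf B inB fs gs F G with length fs ≟ length gs
  ... | yes equal = equal
  ... | no  differ = ⊥-elim (¬¬hf λ hf → differ (hf B inB fs gs F G))

  -- On a two-element set weak half-factoriality implies half-factoriality:
  -- an atom other than some x^{ord x} has every A(g) < ord g, so
  -- 0 < K(A) ≤ 2(n − 1) < 2n and n ∣ K(A) force K(A) = n.
  twoElement-crossNumberOne : ∀ G₁ → ∣ G₁ ∣ ≡ 2 → WeaklyHalfFactorial n G₁ → CrossNumberOne G₁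
  twoElement-crossNumberOne G₁ ∣G₁∣≡2 whf A atom@(over , minA) =
    byHeight (Fin.any? λ x → ordₙ x ≤? A x)
    where
    byHeight : Dec (∃ λ x → ordₙ x ≤ A x) → K A ≡ n
    byHeight (yes (x , ord≤Ax)) = begin
      K A                      ≡⟨ sym (weight-cong gcdₙ (atom-≥ord A minA x ord≤Ax)) ⟩
      K (single x (ordₙ x))    ≡⟨ weight-single gcdₙ x (ordₙ x) ⟩
      ordₙ x * gcdₙ x          ≡⟨ ord*gcd≡n x ⟩
      n                        ∎
      where open ≡-Reasoning
    byHeight (no none) = multiple<2n K>0 K<2n (Equivalence.to (weaklyHalfFactorial⇔ G₁) whf A atom)
      where
      K>0 : 0 < K A
      K>0 = <-≤-trans (proj₁ minA) (∑-mono λ g → m≤m*n (A g) (gcdₙ g) {{gcd-nonZero n g}})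
      term<n : ∀ g → A g * gcdₙ g < n
      term<n g = subst (A g * gcdₙ g <_) (ord*gcd≡n g)
                   (*-monoˡ-< (gcdₙ g) {{gcd-nonZero n g}} (≰⇒> λ ord≤Ag → none (g , ord≤Ag)))
      K≤2[n-1] : K A ≤ 2 * pred n
      K≤2[n-1] = subst (λ s → K A ≤ s * pred n) ∣G₁∣≡2
        (∑-support-≤ G₁ (pred n) (λ g → A g * gcdₙ g)
          (λ g _ → suc[m]≤n⇒m≤pred[n] (term<n g))
          (λ g g∉G₁ → cong (_* gcdₙ g) (n≤0⇒n≡0 (≮⇒≥ λ Ag>0 → g∉G₁ (over g Ag>0)))))
      K<2n : K A < 2 * n
      K<2n = ≤-<-trans K≤2[n-1] (*-monoʳ-< 2 (m≤pred[n]⇒suc[m]≤n ≤-refl))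

  twoElement-halfFactorial : ∀ G₁ → ∣ G₁ ∣ ≡ 2 → WeaklyHalfFactorial n G₁ → HalfFactorial n G₁
  twoElement-halfFactorial G₁ ∣G₁∣≡2 whf =
    crossNumberOne⇒halfFactorial G₁ (twoElement-crossNumberOne G₁ ∣G₁∣≡2 whf)

  -- a pair of distinct elements of G₀ carrying an atom of cross number ≠ 1;
  -- atoms have height at most n, which makes the search finite
  BadPair : Subset n → Set
  BadPair G₀ = ∃ λ x → ∃ λ y → x ∈ G₀ × y ∈ G₀ × x ≢ y ×
               ∃ λ A → (∀ g → A g ≤ n) × Atom n (pair x y) A × K A ≢ n

  badPair? : ∀ G₀ → Dec (BadPair G₀)
  badPair? G₀ = Fin.any? λ x → Fin.any? λ y →
    (x ∈? G₀) ×-dec (y ∈? G₀) ×-dec ¬? (x Fin.≟ y) ×-dec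
    ∃≤? (λ _ → n) (λ A → Atom n (pair x y) A × K A ≢ n)
        (λ A≗B (atom , K≢n) → atom-cong A≗B atom , λ K≡n → K≢n (trans (weight-cong gcdₙ A≗B) K≡n))
        (λ A → atom? (pair x y) A ×-dec ¬? (K A ≟ n))

  -- Either G₀ has a two-element subset that is not half-factorial, or all its
  -- two-element subsets have atoms of cross number 1, and then G₀ is weakly
  -- half-factorial by the local-global principle.
  dichotomy : ∀ G₀ →
    (Σ (Subset n) λ G₁ → G₁ ⊆ G₀ × ∣ G₁ ∣ ≡ 2 × ¬ HalfFactorial n G₁) ⊎ WeaklyHalfFactorial n G₀
  dichotomy G₀ = byBadPair (badPair? G₀)
    where
    byBadPair : Dec (BadPair G₀) →
      (Σ (Subset n) λ G₁ → G₁ ⊆ G₀ × ∣ G₁ ∣ ≡ 2 × ¬ HalfFactorial n G₁) ⊎ WeaklyHalfFactorial n G₀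
    byBadPair (yes (x , y , x∈G₀ , y∈G₀ , x≢y , A , _ , atom , K≢n)) =
      inj₁ (pair x y , pair-⊆ x∈G₀ y∈G₀ , ∣⁅x⁆∪⁅y⁆∣≡2 x y x≢y ,
            λ hf → K≢n (halfFactorial⇒crossNumberOne (pair x y) hf A atom))
    byBadPair (no noBadPair) = inj₂ (Equivalence.from (weaklyHalfFactorial⇔ G₀)
      λ A (over , minA) → localGlobal G₀ pairsIntegral A (over , proj₁ (proj₂ minA)))
      where
      pairsIntegral : PairwiseIntegral G₀
      pairsIntegral x y x∈G₀ y∈G₀ x≢y = crossNumberOne⇒integral (pair x y) λ A atom →
        crossOne A atom (K A ≟ n)
        where
        crossOne : ∀ A → Atom n (pair x y) A → Dec (K A ≡ n) → K A ≡ n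
        crossOne A atom (yes K≡n) = K≡n
        crossOne A atom (no  K≢n) = ⊥-elim (noBadPair (x , y , x∈G₀ , y∈G₀ , x≢y , A ,
          (λ g → ≤-trans (atom-height A (proj₂ atom) g) (ordₙ≤n g)) , atom , K≢n))

corollary5p8 : (n : ℕ) .{{_ : NonZero n}} →
    ((G₀ : Subset n) → WeaklyHalfFactorial n G₀ → HalfFactorial n G₀)
    ⇔ ((G₀ : Subset n) → ¬ HalfFactorial n G₀ →
         Σ (Subset n) (λ G₁ → G₁ ⊆ G₀ × ∣ G₁ ∣ ≡ 2 × ¬ HalfFactorial n G₁))
corollary5p8 n = mk⇔
  -- (1) ⇒ (2): a weakly half-factorial G₀ would be half-factorial
  (λ whf⇒hf G₀ ¬hf → [ id , (λ whf → ⊥-elim (¬hf (whf⇒hf G₀ whf))) ]′ (dichotomy G₀))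
  -- (2) ⇒ (1): a non-half-factorial pair inside a weakly half-factorial G₀
  -- would be weakly half-factorial, hence half-factorial
  (λ pairs G₀ whf → halfFactorial-stable G₀ λ ¬hf →
     let (G₁ , G₁⊆G₀ , ∣G₁∣≡2 , ¬hf₁) = pairs G₀ ¬hf
     in  ¬hf₁ (twoElement-halfFactorial G₁ ∣G₁∣≡2 (whf-⊆ G₁⊆G₀ whf)))
  where open TwoElementSubsets n
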